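{- Let $r\ge 1$ and $n\ge 3$ be integers, and let $rC_n$ denote the disjoint union of $r$ copies of the cycle $C_n$ of length $n$. Then $3\le \chi_{la}(rC_n)\le r+2$.
   Context: For a graph $G=(V,E)$ without $K_2$ components, a bijection $f:E\to\{1,2,\dots,|E|\}$ induces the weight $w(u)=\sum_{uv\in E} f(uv)$ of each vertex $u$. The bijection $f$ is a local antimagic labeling if $w(u)\neq w(v)$ for every edge $uv$. The local antimagic chromatic number $\chi_{la}(G)$ is the minimum number of distinct weights over all local antimagic labelings of $G$. -}

module Defs where

open import Data.Nat using (ℕ; zero; suc; _+_; _*_; _≤_)
open import Data.Nat.DivMod using (_mod_)
open import Data.Fin using (Fin; toℕ; combine; quotRem; _≟_)
open import Data.Fin.Properties using () renaming (_≟_ to _≟F_)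
open import Data.Bool using (if_then_else_; _∨_)
open import Data.List using (List; map; allFin; length; deduplicate)
open import Data.Nat.ListAction using (sum)
open import Data.Product using (_×_; _,_; proj₁; proj₂; Σ; ∃)
open import Relation.Nullary using (¬_)
open import Relation.Nullary.Decidable using (⌊_⌋)
open import Relation.Binary.PropositionalEquality using (_≡_)
open import Function.Definitions using (Bijective)

record Graph : Set where
  field
    nV   : ℕ
    nE   : ℕ
    ends : Fin nE → Fin nV × Fin nV
open Graph public

-- An edge labeling: a bijection f : E → Fin |E|; the label of e is toℕ (f e) + 1,
-- so labels range over {1, …, |E|}.
Labeling : Graph → Set
Labeling G = Σ (Fin (nE G) → Fin (nE G)) λ f → Bijective _≡_ _≡_ f

label : (G : Graph) → Labeling G → Fin (nE G) → ℕ
label G (f , _) e = suc (toℕ (f e))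

incident : (G : Graph) → Fin (nV G) → Fin (nE G) → Data.Bool.Bool
incident G u e = ⌊ u ≟F proj₁ (ends G e) ⌋ ∨ ⌊ u ≟F proj₂ (ends G e) ⌋

weight : (G : Graph) → Labeling G → Fin (nV G) → ℕ
weight G ℓ u = sum (map (λ e → if incident G u e then label G ℓ e else 0) (allFin (nE G)))

IsLocalAntimagic : (G : Graph) → Labeling G → Set
IsLocalAntimagic G ℓ = (e : Fin (nE G)) →
  ¬ (weight G ℓ (proj₁ (ends G e)) ≡ weight G ℓ (proj₂ (ends G e)))

numWeights : (G : Graph) → Labeling G → ℕ
numWeights G ℓ = length (deduplicate Data.Nat._≟_ (map (weight G ℓ) (allFin (nV G))))

IsChiLa : Graph → ℕ → Set
IsChiLa G k =
  (Σ (Labeling G) λ ℓ → IsLocalAntimagic G ℓ × numWeights G ℓ ≡ k) ×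
  ((ℓ : Labeling G) → IsLocalAntimagic G ℓ → k ≤ numWeights G ℓ)

nextMod : ∀ {n} → Fin n → Fin n
nextMod {suc k} j = suc (toℕ j) mod (suc k)

-- r C_n : vertex (i , j) ↦ combine i j  (copy i ∈ Fin r, position j ∈ Fin n);
-- edge (i , j) joins vertex (i , j) and vertex (i , j+1 mod n).
rC : (r n : ℕ) → Graph
rC r n = record
  { nV = r * n
  ; nE = r * n
  ; ends = λ e → let (j , i) = quotRem {r} n e in combine i j , combine i (nextMod j)
  }

module Submission where

-- A vertex of a cycle lies on exactly two edges, so its weight is the sum of their labels.
-- Lower bound: if a local antimagic labelling of r Cₙ had only two weights, they would alternate
-- along each cycle. For consecutive edges e₀, e₁, e₂ the weights of the vertices between them differ
-- by L(e₂) − L(e₀), so every second label would keep changing by the same nonzero amount, which a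
-- bounded labelling cannot do.
-- Upper bound: along copy i alternate increasing labels from the block of copy i with decreasing
-- labels from the block of the mirror copy r − 1 − i. Consecutive labels then add up to n r + 1 or
-- n r + 2, and only the first vertex of each copy can carry another weight.
-- Since local antimagicity and the number of weights are decidable, exhaustive search over all
-- labellings yields the least attainable number of weights, that is χ_la.

open import Defs
open import Data.Bool using (Bool; true; false; if_then_else_; _∨_)
open import Data.Bool.Properties using (∨-zeroʳ)
open import Data.Empty using (⊥; ⊥-elim)
open import Data.Fin as Fin
  using (Fin; toℕ; fromℕ; fromℕ<; inject₁; combine; remQuot; quotRem; opposite; punchOut)
import Data.Fin.Properties as FinP
open import Data.Fin.Properties
  using ( any?; all?; toℕ-injective; toℕ<n; toℕ-fromℕ; toℕ-fromℕ<; toℕ-inject₁; toℕ-combine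
        ; combine-remQuot; remQuot-combine; combine-injective; combine-injectiveʳ
        ; opposite-prop; opposite-involutive; injective⇒≤; punchOut-injective)
  renaming (_≟_ to _≟F_)
open import Data.List using (List; []; _∷_; map; allFin; length; deduplicate; tabulate)
open import Data.List.Membership.Propositional using (_∈_; _─_)
open import Data.List.Membership.Propositional.Properties
  using (∈-deduplicate⁺; ∈-deduplicate⁻; ∈-map⁺; ∈-map⁻; ∈-allFin)
open import Data.List.Properties
  using (map-tabulate; map-cong; length-removeAt′; length-map; length-tabulate)
open import Data.List.Relation.Binary.Subset.Propositional using (_⊆_)
import Data.List.Relation.Unary.All as All
open import Data.List.Relation.Unary.Any using (here; there; index)
open import Data.List.Relation.Unary.Unique.DecPropositional.Properties using (deduplicate-!)
open import Data.List.Relation.Unary.Unique.Propositional using (Unique; _∷_)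
open import Data.Nat
  using (ℕ; zero; suc; _+_; _*_; _∸_; _≤_; _<_; _≟_; _≤?_; z≤n; s≤s; s≤s⁻¹; z<s; NonZero; ⌊_/2⌋; parity)
open import Data.Nat.DivMod using (_%_; n%n≡0; m<n⇒m%n≡m; [m+kn]%n≡m%n; m*n%n≡0)
open import Data.Nat.ListAction using (sum)
open import Data.Nat.Properties
  using ( ≤-refl; ≤-trans; ≤-reflexive; ≤-pred; ≰⇒>; <-irrefl; <⇒≢; <-cmp; n<1+n; n≤1+n; n≢0⇒n>0
        ; m≤m+n; m<m+n; m≤n⇒m≤1+n; m<n⇒m<1+n; m≤n⇒m<n∨m≡n; suc-injective
        ; +-comm; +-assoc; +-suc; +-identityʳ; *-comm; +-cancelˡ-<; +-monoʳ-≤; +-mono-≤; m∸n+n≡m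
        ; ⌊n/2⌋≤n; n≡⌊n+n/2⌋; n≡⌈n+n/2⌉; module ≤-Reasoning)
open import Data.Nat.Tactic.RingSolver using (solve-∀)
open import Data.Parity.Base using (Parity; 0ℙ; 1ℙ; _⁻¹)
open import Data.Parity.Properties using (+-homo-+; p+p≡0ℙ)
open import Data.Product using (_×_; _,_; proj₁; proj₂; Σ; ∃; ∃₂; swap)
open import Data.Sum using (_⊎_; inj₁; inj₂; [_,_]′)
import Data.Vec.Functional as Vec
open import Function using (_∘_; id)
open import Function.Definitions using (Bijective; Injective; Surjective)
open import Relation.Binary.Definitions using (tri<; tri≈; tri>)
open import Relation.Binary.PropositionalEquality
open import Relation.Nullary using (¬_; Dec; yes; no)
open import Relation.Nullary.Decidable using (⌊_⌋; map′; isYes≗does; dec-true; dec-false; _→-dec_; ¬?)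

sum-tabulate-zero : ∀ {N} (g : Fin N → ℕ) → (∀ e → g e ≡ 0) → sum (tabulate g) ≡ 0
sum-tabulate-zero {zero}  g g≡0 = refl
sum-tabulate-zero {suc N} g g≡0 rewrite g≡0 Fin.zero = sum-tabulate-zero (g ∘ Fin.suc) (g≡0 ∘ Fin.suc)

sum-tabulate-point : ∀ {N} (g : Fin N → ℕ) (a : Fin N) → (∀ e → e ≢ a → g e ≡ 0) →
                     sum (tabulate g) ≡ g a
sum-tabulate-point {suc N} g Fin.zero g≡0 =
  trans (cong (g Fin.zero +_) (sum-tabulate-zero (g ∘ Fin.suc) (λ e → g≡0 (Fin.suc e) λ ())))
        (+-identityʳ _)
sum-tabulate-point {suc N} g (Fin.suc a) g≡0 rewrite g≡0 Fin.zero (λ ()) =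
  sum-tabulate-point (g ∘ Fin.suc) a (λ e e≢a → g≡0 (Fin.suc e) (e≢a ∘ FinP.suc-injective))

sum-tabulate-pair : ∀ {N} (g : Fin N → ℕ) {a b : Fin N} → a ≢ b → (∀ e → e ≢ a → e ≢ b → g e ≡ 0) →
                    sum (tabulate g) ≡ g a + g b
sum-tabulate-pair {suc N} g {Fin.zero} {Fin.zero} a≢b _ = ⊥-elim (a≢b refl)
sum-tabulate-pair {suc N} g {Fin.zero} {Fin.suc b} _ g≡0 =
  cong (g Fin.zero +_)
    (sum-tabulate-point (g ∘ Fin.suc) b (λ e e≢b → g≡0 (Fin.suc e) (λ ()) (e≢b ∘ FinP.suc-injective)))
sum-tabulate-pair {suc N} g {Fin.suc a} {Fin.zero} _ g≡0 =
  trans (cong (g Fin.zero +_)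
          (sum-tabulate-point (g ∘ Fin.suc) a (λ e e≢a → g≡0 (Fin.suc e) (e≢a ∘ FinP.suc-injective) (λ ()))))
        (+-comm (g Fin.zero) (g (Fin.suc a)))
sum-tabulate-pair {suc N} g {Fin.suc a} {Fin.suc b} a≢b g≡0 rewrite g≡0 Fin.zero (λ ()) (λ ()) =
  sum-tabulate-pair (g ∘ Fin.suc) (a≢b ∘ cong Fin.suc)
    (λ e e≢a e≢b → g≡0 (Fin.suc e) (e≢a ∘ FinP.suc-injective) (e≢b ∘ FinP.suc-injective))

module _ (G : Graph) where

  private
    ⌊⌋-true : ∀ {u v : Fin (nV G)} → u ≡ v → ⌊ u ≟F v ⌋ ≡ true
    ⌊⌋-true {u} {v} u≡v = trans (isYes≗does (u ≟F v)) (dec-true (u ≟F v) u≡v)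

    ⌊⌋-false : ∀ {u v : Fin (nV G)} → u ≢ v → ⌊ u ≟F v ⌋ ≡ false
    ⌊⌋-false {u} {v} u≢v = trans (isYes≗does (u ≟F v)) (dec-false (u ≟F v) u≢v)

  incident-source : ∀ {u e} → u ≡ proj₁ (ends G e) → incident G u e ≡ true
  incident-source {u} {e} u≡s = cong (_∨ ⌊ u ≟F proj₂ (ends G e) ⌋) (⌊⌋-true u≡s)

  incident-target : ∀ {u e} → u ≡ proj₂ (ends G e) → incident G u e ≡ true
  incident-target {u} {e} u≡t = trans (cong (⌊ u ≟F proj₁ (ends G e) ⌋ ∨_) (⌊⌋-true u≡t)) (∨-zeroʳ _)

  incident-neither : ∀ {u e} → u ≢ proj₁ (ends G e) → u ≢ proj₂ (ends G e) → incident G u e ≡ false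
  incident-neither u≢s u≢t = cong₂ _∨_ (⌊⌋-false u≢s) (⌊⌋-false u≢t)

  weight-two-edges : (ℓ : Labeling G) (u : Fin (nV G)) {e₁ e₂ : Fin (nE G)} → e₁ ≢ e₂ →
                     incident G u e₁ ≡ true → incident G u e₂ ≡ true →
                     (∀ e → e ≢ e₁ → e ≢ e₂ → incident G u e ≡ false) →
                     weight G ℓ u ≡ label G ℓ e₁ + label G ℓ e₂
  weight-two-edges ℓ u {e₁} {e₂} e₁≢e₂ inc₁ inc₂ others = begin
    weight G ℓ u                   ≡⟨ cong sum (map-tabulate id g) ⟩
    sum (tabulate g)               ≡⟨ sum-tabulate-pair g e₁≢e₂ (λ e e≢e₁ → cong (select e) ∘ others e e≢e₁) ⟩
    g e₁ + g e₂                    ≡⟨ cong₂ _+_ (cong (select e₁) inc₁) (cong (select e₂) inc₂) ⟩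
    label G ℓ e₁ + label G ℓ e₂    ∎
    where
    open ≡-Reasoning
    select : Fin (nE G) → Bool → ℕ
    select e b = if b then label G ℓ e else 0
    g : Fin (nE G) → ℕ
    g e = select e (incident G u e)

  weight-cong : (ℓ ℓ′ : Labeling G) → (∀ e → proj₁ ℓ e ≡ proj₁ ℓ′ e) →
                ∀ u → weight G ℓ u ≡ weight G ℓ′ u
  weight-cong ℓ ℓ′ ℓ≗ℓ′ u =
    cong sum (map-cong (λ e → cong (λ x → if incident G u e then suc (toℕ x) else 0) (ℓ≗ℓ′ e))
                       (allFin (nE G)))

-- Counting distinct weights

∈-─ : ∀ {A : Set} {x z : A} {xs : List A} (x∈xs : x ∈ xs) → z ∈ xs → z ≢ x → z ∈ xs ─ x∈xs
∈-─ (here x≡y)  (here z≡y)  z≢x = ⊥-elim (z≢x (trans z≡y (sym x≡y)))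
∈-─ (here _)    (there z∈)  _   = z∈
∈-─ (there _)   (here z≡y)  _   = here z≡y
∈-─ (there x∈)  (there z∈)  z≢x = there (∈-─ x∈ z∈ z≢x)

Unique⇒length-≤ : ∀ {A : Set} {xs ys : List A} → Unique xs → xs ⊆ ys → length xs ≤ length ys
Unique⇒length-≤ {xs = []}     _              _  = z≤n
Unique⇒length-≤ {xs = x ∷ xs} {ys} (x∉xs ∷ u) xs⊆ys =
  ≤-trans (s≤s (Unique⇒length-≤ u xs⊆ys─x)) (≤-reflexive (sym (length-removeAt′ ys (index x∈ys))))
  where
  x∈ys : x ∈ ys
  x∈ys = xs⊆ys (here refl)
  xs⊆ys─x : xs ⊆ ys ─ x∈ys
  xs⊆ys─x z∈xs = ∈-─ x∈ys (xs⊆ys (there z∈xs)) (λ z≡x → All.lookup x∉xs z∈xs (sym z≡x))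

length≤2⇒two-valued : (ds : List ℕ) → length ds ≤ 2 → ∃₂ λ a b → ∀ {z} → z ∈ ds → z ≡ a ⊎ z ≡ b
length≤2⇒two-valued []          _ = 0 , 0 , λ ()
length≤2⇒two-valued (x ∷ [])     _ = x , x , λ { (here p) → inj₁ p }
length≤2⇒two-valued (x ∷ y ∷ []) _ = x , y , λ { (here p) → inj₁ p ; (there (here p)) → inj₂ p }
length≤2⇒two-valued (_ ∷ _ ∷ _ ∷ _) (s≤s (s≤s ()))

module _ (G : Graph) (ℓ : Labeling G) where

  private
    weights : List ℕ
    weights = map (weight G ℓ) (allFin (nV G))

  numWeights-≤ : (S : List ℕ) → (∀ u → weight G ℓ u ∈ S) → numWeights G ℓ ≤ length S
  numWeights-≤ S w∈S = Unique⇒length-≤ (deduplicate-! _≟_ weights) dedup⊆S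
    where
    dedup⊆S : deduplicate _≟_ weights ⊆ S
    dedup⊆S z∈ with ∈-map⁻ (weight G ℓ) (∈-deduplicate⁻ _≟_ weights z∈)
    ... | u , _ , refl = w∈S u

  numWeights≤2⇒two-valued : numWeights G ℓ ≤ 2 → ∃₂ λ a b → ∀ u → weight G ℓ u ≡ a ⊎ weight G ℓ u ≡ b
  numWeights≤2⇒two-valued ≤2 with length≤2⇒two-valued (deduplicate _≟_ weights) ≤2
  ... | a , b , ab = a , b , λ u → ab (∈-deduplicate⁺ _≟_ (∈-map⁺ (weight G ℓ) (∈-allFin u)))

-- Existence of χ_la

Fin-injective⇒surjective : ∀ {N} {f : Fin N → Fin N} → Injective _≡_ _≡_ f → Surjective _≡_ _≡_ f
Fin-injective⇒surjective {suc N} {f} f-inj y with any? (λ x → f x ≟F y)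
... | yes (x , fx≡y) = x , λ { refl → fx≡y }
... | no ∄x = ⊥-elim (<-irrefl refl (injective⇒≤ {f = avoid-y} avoid-y-injective))
  where
  avoid-y : Fin (suc N) → Fin N
  avoid-y x = punchOut {i = y} {j = f x} (λ y≡fx → ∄x (x , sym y≡fx))
  avoid-y-injective : Injective _≡_ _≡_ avoid-y
  avoid-y-injective {a} {b} =
    f-inj ∘ punchOut-injective (λ y≡fa → ∄x (a , sym y≡fa)) (λ y≡fb → ∄x (b , sym y≡fb))

Bijective-≗ : ∀ {N} {f g : Fin N → Fin N} → (∀ x → f x ≡ g x) →
              Bijective _≡_ _≡_ f → Bijective _≡_ _≡_ g
Bijective-≗ {f = f} {g} f≗g (f-inj , f-surj) =
  (λ {x} {y} gx≡gy → f-inj (trans (f≗g x) (trans gx≡gy (sym (f≗g y))))) ,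
  λ y → proj₁ (f-surj y) , λ {z} z≡x → trans (sym (f≗g z)) (proj₂ (f-surj y) z≡x)

∃-fun? : ∀ N {M} {P : (Fin N → Fin M) → Set} → (∀ f → Dec (P f)) →
         (∀ {f g} → (∀ x → f x ≡ g x) → P f → P g) → Dec (∃ P)
∃-fun? zero P? P-resp with P? (λ ())
... | yes p  = yes (_ , p)
... | no ¬p  = no λ (f , pf) → ¬p (P-resp (λ ()) pf)
∃-fun? (suc N) {P = P} P? P-resp with any? (λ y → ∃-fun? N (P? ∘ (y Vec.∷_)) (P-resp ∘ cons-≗ y))
  where
  cons-≗ : ∀ y {f g : Fin N → _} → (∀ x → f x ≡ g x) → ∀ x → (y Vec.∷ f) x ≡ (y Vec.∷ g) x
  cons-≗ y f≗g Fin.zero    = refl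
  cons-≗ y f≗g (Fin.suc x) = f≗g x
... | yes (y , g , pg) = yes (_ , pg)
... | no ∄ = no λ (f , pf) → ∄ (Vec.head f , Vec.tail f , P-resp head∷tail pf)
  where
  head∷tail : ∀ {f : Fin (suc N) → _} x → f x ≡ (Vec.head f Vec.∷ Vec.tail f) x
  head∷tail Fin.zero    = refl
  head∷tail (Fin.suc x) = refl

least-≤ : {Q : ℕ → Set} → (∀ k → Dec (Q k)) → ∀ B →
          (∃ λ k → Q k × k ≤ B × ∀ j → j < k → ¬ Q j) ⊎ (∀ j → j ≤ B → ¬ Q j)
least-≤ Q? zero with Q? 0
... | yes q = inj₁ (0 , q , z≤n , λ _ ())
... | no ¬q = inj₂ λ { _ z≤n → ¬q }
least-≤ {Q} Q? (suc B) with least-≤ Q? B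
... | inj₁ (k , q , k≤B , k-least) = inj₁ (k , q , m≤n⇒m≤1+n k≤B , k-least)
... | inj₂ none≤B with Q? (suc B)
...   | yes q = inj₁ (suc B , q , ≤-refl , λ j j<1+B → none≤B j (s≤s⁻¹ j<1+B))
...   | no ¬q = inj₂ none≤1+B
  where
  none≤1+B : ∀ j → j ≤ suc B → ¬ Q j
  none≤1+B j j≤1+B with m≤n⇒m<n∨m≡n j≤1+B
  ... | inj₁ j<1+B = none≤B j (s≤s⁻¹ j<1+B)
  ... | inj₂ refl  = ¬q

Realizable : Graph → ℕ → Set
Realizable G k = Σ (Labeling G) λ ℓ → IsLocalAntimagic G ℓ × numWeights G ℓ ≡ k

module _ (G : Graph) where

  private
    M : ℕ
    M = nE G

    injective? : (f : Fin M → Fin M) → Dec (Injective _≡_ _≡_ f)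
    injective? f = map′ (λ inj {x} {y} → inj x y) (λ (inj : Injective _≡_ _≡_ f) x y → inj)
                        (all? λ x → all? λ y → (f x ≟F f y) →-dec (x ≟F y))

    bijective? : (f : Fin M → Fin M) → Dec (Bijective _≡_ _≡_ f)
    bijective? f =
      map′ (λ (inj : Injective _≡_ _≡_ f) → inj , Fin-injective⇒surjective inj) proj₁ (injective? f)

    localAntimagic? : (ℓ : Labeling G) → Dec (IsLocalAntimagic G ℓ)
    localAntimagic? ℓ = all? λ e → ¬? (weight G ℓ (proj₁ (ends G e)) ≟ weight G ℓ (proj₂ (ends G e)))

    RealizedBy : ℕ → (Fin M → Fin M) → Set
    RealizedBy k f = Σ (Bijective _≡_ _≡_ f) λ f-bij →
                       IsLocalAntimagic G (f , f-bij) × numWeights G (f , f-bij) ≡ k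

    -- label ignores the bijectivity proof, so the refutations below apply to any proof of it.
    realizedBy? : ∀ k f → Dec (RealizedBy k f)
    realizedBy? k f with bijective? f
    ... | no ¬bij = no (¬bij ∘ proj₁)
    ... | yes bij with localAntimagic? (f , bij) | numWeights G (f , bij) ≟ k
    ...   | yes am  | yes ≡k = yes (bij , am , ≡k)
    ...   | no ¬am  | _      = no (¬am ∘ proj₁ ∘ proj₂)
    ...   | _       | no ≢k  = no (≢k ∘ proj₂ ∘ proj₂)

    realizedBy-≗ : ∀ {k f g} → (∀ x → f x ≡ g x) → RealizedBy k f → RealizedBy k g
    realizedBy-≗ {k} {f} {g} f≗g (f-bij , am , ≡k) = g-bij , g-am , trans (sym same-count) ≡k
      where
      g-bij : Bijective _≡_ _≡_ g
      g-bij = Bijective-≗ f≗g f-bij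
      same-weight : ∀ u → weight G (f , f-bij) u ≡ weight G (g , g-bij) u
      same-weight = weight-cong G (f , f-bij) (g , g-bij) f≗g
      g-am : IsLocalAntimagic G (g , g-bij)
      g-am e w≡w =
        am e (trans (same-weight (proj₁ (ends G e))) (trans w≡w (sym (same-weight (proj₂ (ends G e))))))
      same-count : numWeights G (f , f-bij) ≡ numWeights G (g , g-bij)
      same-count = cong (length ∘ deduplicate _≟_) (map-cong same-weight (allFin (nV G)))

  realizable? : ∀ k → Dec (Realizable G k)
  realizable? k = map′ (λ (f , f-bij , p) → (f , f-bij) , p) (λ ((f , f-bij) , p) → f , f-bij , p)
                       (∃-fun? M (realizedBy? k) realizedBy-≗)

  χla-exists : (ℓ : Labeling G) → IsLocalAntimagic G ℓ → Σ ℕ λ k → IsChiLa G k × k ≤ numWeights G ℓ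
  χla-exists ℓ am with least-≤ realizable? (numWeights G ℓ)
  ... | inj₂ none = ⊥-elim (none _ ≤-refl (ℓ , am , refl))
  ... | inj₁ (k , realized , k≤ , k-least) = k , (realized , minimal) , k≤
    where
    minimal : (ℓ′ : Labeling G) → IsLocalAntimagic G ℓ′ → k ≤ numWeights G ℓ′
    minimal ℓ′ am′ with k ≤? numWeights G ℓ′
    ... | yes k≤ = k≤
    ... | no k≰ = ⊥-elim (k-least _ (≰⇒> k≰) (ℓ′ , am′ , refl))

-- Disjoint unions of cycles

module Cycle (n₁ : ℕ) where

  n : ℕ
  n = suc n₁

  next : Fin n → Fin n
  next = nextMod

  prev : Fin n → Fin n
  prev Fin.zero    = fromℕ n₁
  prev (Fin.suc j) = inject₁ j

  toℕ-next : ∀ {j y} → toℕ j ≡ y → y < n₁ → toℕ (next j) ≡ suc y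
  toℕ-next {j} refl y<n₁ = trans (toℕ-fromℕ< _) (m<n⇒m%n≡m (s≤s y<n₁))

  toℕ-next-last : ∀ {j} → toℕ j ≡ n₁ → toℕ (next j) ≡ 0
  toℕ-next-last {j} j≡n₁ = trans (toℕ-fromℕ< _) (trans (cong (λ y → suc y % n) j≡n₁) (n%n≡0 n))

  toℕ-prev-zero : ∀ {j} → toℕ j ≡ 0 → toℕ (prev j) ≡ n₁
  toℕ-prev-zero {Fin.zero} _ = toℕ-fromℕ n₁

  toℕ-prev-suc : ∀ {j y} → toℕ j ≡ suc y → toℕ (prev j) ≡ y
  toℕ-prev-suc {Fin.suc j} refl = toℕ-inject₁ j

  next-prev : ∀ j → next (prev j) ≡ j
  next-prev Fin.zero    = toℕ-injective (toℕ-next-last (toℕ-fromℕ n₁))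
  next-prev (Fin.suc j) = toℕ-injective (toℕ-next (toℕ-inject₁ j) (s≤s⁻¹ (toℕ<n (Fin.suc j))))

  prev-next : ∀ j → prev (next j) ≡ j
  prev-next j with m≤n⇒m<n∨m≡n (s≤s⁻¹ (toℕ<n j))
  ... | inj₁ j<n₁ = toℕ-injective (toℕ-prev-suc (toℕ-next refl j<n₁))
  ... | inj₂ j≡n₁ = toℕ-injective (trans (toℕ-prev-zero (toℕ-next-last j≡n₁)) (sym j≡n₁))

  prev≢ : 1 ≤ n₁ → ∀ j → prev j ≢ j
  prev≢ n₁≥1 Fin.zero    prev≡ = <⇒≢ n₁≥1 (sym (trans (sym (toℕ-fromℕ n₁)) (cong toℕ prev≡)))
  prev≢ _    (Fin.suc j) prev≡ = <-irrefl (trans (sym (toℕ-inject₁ j)) (cong toℕ prev≡)) (n<1+n (toℕ j))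

module CycleUnion (r n₁ : ℕ) where

  open Cycle n₁ public

  G : Graph
  G = rC r n

  -- Edge e of rC r n runs from vertex e to vertex σ e, so the two edges at u are u and π u.
  σ : Fin (r * n) → Fin (r * n)
  σ e = proj₂ (ends G e)

  π : Fin (r * n) → Fin (r * n)
  π u = let (i , j) = remQuot {r} n u in combine i (prev j)

  source≡ : ∀ e → proj₁ (ends G e) ≡ e
  source≡ = combine-remQuot {r} n

  quotRem-combine : ∀ i j → quotRem {r} n (combine i j) ≡ (j , i)
  quotRem-combine i j = cong swap (remQuot-combine {r} {n} i j)

  σ-combine : ∀ i j → σ (combine i j) ≡ combine i (next j)
  σ-combine i j rewrite quotRem-combine i j = refl

  π-combine : ∀ i j → π (combine i j) ≡ combine i (prev j)
  π-combine i j rewrite quotRem-combine i j = refl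

  σ-π : ∀ u → σ (π u) ≡ u
  σ-π u = let (i , j) = remQuot {r} n u in begin
    σ (π u)                   ≡⟨ σ-combine i (prev j) ⟩
    combine i (next (prev j)) ≡⟨ cong (combine i) (next-prev j) ⟩
    combine i j               ≡⟨ combine-remQuot {r} n u ⟩
    u                         ∎
    where open ≡-Reasoning

  π-σ : ∀ u → π (σ u) ≡ u
  π-σ u = let (i , j) = remQuot {r} n u in begin
    π (σ u)                   ≡⟨ cong (π ∘ σ) (sym (combine-remQuot {r} n u)) ⟩
    π (σ (combine i j))       ≡⟨ cong π (σ-combine i j) ⟩
    π (combine i (next j))    ≡⟨ π-combine i (next j) ⟩
    combine i (prev (next j)) ≡⟨ cong (combine i) (prev-next j) ⟩
    combine i j               ≡⟨ combine-remQuot {r} n u ⟩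
    u                         ∎
    where open ≡-Reasoning

  π≢ : 1 ≤ n₁ → ∀ u → π u ≢ u
  π≢ n₁≥1 u π≡u = let (i , j) = remQuot {r} n u in
    prev≢ n₁≥1 j (combine-injectiveʳ i (prev j) i j (trans π≡u (sym (combine-remQuot {r} n u))))

  weight-rC : 1 ≤ n₁ → (ℓ : Labeling G) → ∀ u → weight G ℓ u ≡ label G ℓ u + label G ℓ (π u)
  weight-rC n₁≥1 ℓ u =
    weight-two-edges G ℓ u (π≢ n₁≥1 u ∘ sym)
      (incident-source G (sym (source≡ u))) (incident-target G (sym (σ-π u))) not-incident
    where
    not-incident : ∀ e → e ≢ u → e ≢ π u → incident G u e ≡ false
    not-incident e e≢u e≢πu =
      incident-neither G (λ u≡s → e≢u (trans (sym (source≡ e)) (sym u≡s)))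
                         (λ u≡σe → e≢πu (trans (sym (π-σ e)) (cong π (sym u≡σe))))

-- Lower bound

module _ {N : ℕ} (σ : Fin N → Fin N) (L W : Fin N → ℕ)
         (W-σ : ∀ y → W (σ y) ≡ L (σ y) + L y) (proper : ∀ y → W y ≢ W (σ y)) where

  -- W alternates along σ, so W (σ (σ x)) − W (σ x) = L (σ (σ x)) − L x has a fixed sign on
  -- σ²-orbits: from a point where it is positive, L increases forever.
  proper-two-valued⇒unbounded : ∀ {a b B} → (∀ y → W y ≡ a ⊎ W y ≡ b) → (∀ y → L y ≤ B) → Fin N → ⊥
  proper-two-valued⇒unbounded {a} {b} {B} two-valued L≤B v =
    let x , asc = ascending-somewhere
    in <-irrefl refl (≤-trans (m≤m+n (suc B) (L x)) (climb (suc B) asc))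
    where
    alternate : ∀ x → W (σ (σ x)) ≡ W x
    alternate x with two-valued x | two-valued (σ x) | two-valued (σ (σ x))
    ... | inj₁ p | inj₁ q | _      = ⊥-elim (proper x (trans p (sym q)))
    ... | inj₂ p | inj₂ q | _      = ⊥-elim (proper x (trans p (sym q)))
    ... | _      | inj₁ q | inj₁ s = ⊥-elim (proper (σ x) (trans q (sym s)))
    ... | _      | inj₂ q | inj₂ s = ⊥-elim (proper (σ x) (trans q (sym s)))
    ... | inj₁ p | inj₂ _ | inj₁ s = trans s (sym p)
    ... | inj₂ p | inj₁ _ | inj₂ s = trans s (sym p)

    Ascending : Fin N → Set
    Ascending x = W (σ x) < W (σ (σ x))

    ascending-somewhere : ∃ Ascending
    ascending-somewhere with <-cmp (W (σ v)) (W (σ (σ v)))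
    ... | tri< asc _ _ = v , asc
    ... | tri≈ _ eq _  = ⊥-elim (proper (σ v) eq)
    ... | tri> _ _ gt  = σ v , subst (W (σ (σ v)) <_) (sym (alternate (σ v))) gt

    ascending-σσ : ∀ {x} → Ascending x → Ascending (σ (σ x))
    ascending-σσ {x} = subst₂ _<_ (sym (alternate (σ x))) (sym (alternate (σ (σ x))))

    L-increases : ∀ {x} → Ascending x → L x < L (σ (σ x))
    L-increases {x} asc = +-cancelˡ-< (L (σ x)) (L x) (L (σ (σ x)))
      (subst₂ _<_ (W-σ x) (trans (W-σ (σ x)) (+-comm (L (σ (σ x))) (L (σ x)))) asc)

    climb : ∀ k {x} → Ascending x → k + L x ≤ B
    climb zero    {x} _   = L≤B x
    climb (suc k) {x} asc = begin
      suc k + L x     ≡⟨ +-suc k (L x) ⟨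
      k + suc (L x)   ≤⟨ +-monoʳ-≤ k (L-increases asc) ⟩
      k + L (σ (σ x)) ≤⟨ climb k (ascending-σσ asc) ⟩
      B               ∎
      where open ≤-Reasoning

numWeights-rC-≥3 : ∀ r n₁ → 1 ≤ r → 1 ≤ n₁ → (ℓ : Labeling (rC r (suc n₁))) →
                   IsLocalAntimagic (rC r (suc n₁)) ℓ → 3 ≤ numWeights (rC r (suc n₁)) ℓ
numWeights-rC-≥3 r@(suc _) n₁ _ n₁≥1 ℓ am with 3 ≤? numWeights (rC r (suc n₁)) ℓ
... | yes ≥3 = ≥3
... | no ≱3 with numWeights≤2⇒two-valued (rC r (suc n₁)) ℓ (≤-pred (≰⇒> ≱3))
... | _ , _ , two-valued =
  ⊥-elim (proper-two-valued⇒unbounded σ (label G ℓ) (weight G ℓ) W-σ proper two-valued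
            (λ e → toℕ<n (proj₁ ℓ e)) (combine {r} {n} Fin.zero Fin.zero))
  where
  open CycleUnion r n₁
  W-σ : ∀ e → weight G ℓ (σ e) ≡ label G ℓ (σ e) + label G ℓ e
  W-σ e = trans (weight-rC n₁≥1 ℓ (σ e)) (cong (λ e′ → label G ℓ (σ e) + label G ℓ e′) (π-σ e))
  proper : ∀ e → weight G ℓ e ≢ weight G ℓ (σ e)
  proper e = am e ∘ trans (cong (weight G ℓ) (source≡ e))

-- Upper bound

halves : ∀ m → ∃ λ h → m ≡ h + h ⊎ m ≡ suc (h + h)
halves zero = 0 , inj₁ refl
halves (suc m) with halves m
... | h , inj₁ m≡2h   = h , inj₂ (cong suc m≡2h)
... | h , inj₂ m≡2h+1 = suc h , inj₁ (cong suc (trans m≡2h+1 (sym (+-suc h h))))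

parity-even : ∀ h → parity (h + h) ≡ 0ℙ
parity-even h = trans (+-homo-+ h h) (p+p≡0ℙ (parity h))

parity-odd : ∀ h → parity (suc (h + h)) ≡ 1ℙ
parity-odd h = trans (+-homo-+ 1 (h + h)) (cong _⁻¹ (parity-even h))

opposite-injective : ∀ {m} {i j : Fin m} → opposite i ≡ opposite j → i ≡ j
opposite-injective {i = i} {j} eq =
  trans (sym (opposite-involutive i)) (trans (cong opposite eq) (opposite-involutive j))

byParity : {A : Set} → Parity → A → A → A
byParity 0ℙ even _   = even
byParity 1ℙ _    odd = odd

byParity-0ℙ : ∀ {A : Set} {p} {even odd : A} → p ≡ 0ℙ → byParity p even odd ≡ even
byParity-0ℙ refl = refl

byParity-1ℙ : ∀ {A : Set} {p} {even odd : A} → p ≡ 1ℙ → byParity p even odd ≡ odd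
byParity-1ℙ refl = refl

*+-nonzero-remainder≢* : ∀ m .{{_ : NonZero m}} q c k → 0 < c → c < m → m * q + c ≢ m * k
*+-nonzero-remainder≢* m q c k c>0 c<m eq = <⇒≢ c>0 (sym (begin
  c               ≡⟨ m<n⇒m%n≡m c<m ⟨
  c % m           ≡⟨ [m+kn]%n≡m%n c q m ⟨
  (c + q * m) % m ≡⟨ cong (_% m) (trans (+-comm c (q * m)) (cong (_+ c) (*-comm q m))) ⟩
  (m * q + c) % m ≡⟨ cong (_% m) eq ⟩
  (m * k) % m     ≡⟨ cong (_% m) (*-comm m k) ⟩
  (k * m) % m     ≡⟨ m*n%n≡0 k m ⟩
  0               ∎))
  where open ≡-Reasoning

module Construction (r n₁ : ℕ) (n₁≥2 : 2 ≤ n₁) where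

  open CycleUnion r n₁

  n₁≥1 : 1 ≤ n₁
  n₁≥1 = ≤-trans (n≤1+n 1) n₁≥2

  half : Fin n → Fin n
  half j = fromℕ< (s≤s (≤-trans (⌊n/2⌋≤n (toℕ j)) (s≤s⁻¹ (toℕ<n j))))

  toℕ-half-even : ∀ {j} h → toℕ j ≡ h + h → toℕ (half j) ≡ h
  toℕ-half-even h j≡2h = trans (toℕ-fromℕ< _) (trans (cong ⌊_/2⌋ j≡2h) (sym (n≡⌊n+n/2⌋ h)))

  toℕ-half-odd : ∀ {j} h → toℕ j ≡ suc (h + h) → toℕ (half j) ≡ h
  toℕ-half-odd h j≡2h+1 = trans (toℕ-fromℕ< _) (trans (cong ⌊_/2⌋ j≡2h+1) (sym (n≡⌈n+n/2⌉ h)))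

  toℕ-opposite-half : ∀ {j} h → toℕ j ≡ suc (h + h) → toℕ (opposite (half j)) + h ≡ n₁
  toℕ-opposite-half {j} h j≡2h+1 = begin
    toℕ (opposite (half j)) + h ≡⟨ cong (_+ h) (opposite-prop (half j)) ⟩
    n ∸ suc (toℕ (half j)) + h  ≡⟨ cong (λ x → n₁ ∸ x + h) (toℕ-half-odd h j≡2h+1) ⟩
    n₁ ∸ h + h                  ≡⟨ m∸n+n≡m {n₁} {h} h≤n₁ ⟩
    n₁                          ∎
    where
    open ≡-Reasoning
    h≤n₁ : h ≤ n₁
    h≤n₁ = ≤-trans (m≤m+n h h) (≤-trans (n≤1+n (h + h)) (subst (_≤ n₁) j≡2h+1 (s≤s⁻¹ (toℕ<n j))))

  -- With labels toℕ + 1: position 2h of copy i gets n i + h + 1, position 2h + 1 gets n (r − i) − h.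
  edgeLabel : Fin r → Fin n → Fin (r * n)
  edgeLabel i j = byParity (parity (toℕ j)) (combine i (half j)) (combine (opposite i) (opposite (half j)))

  edgeLabel-even : ∀ i {j} h → toℕ j ≡ h + h → edgeLabel i j ≡ combine i (half j)
  edgeLabel-even i h j≡2h = byParity-0ℙ (trans (cong parity j≡2h) (parity-even h))

  edgeLabel-odd : ∀ i {j} h → toℕ j ≡ suc (h + h) → edgeLabel i j ≡ combine (opposite i) (opposite (half j))
  edgeLabel-odd i h j≡2h+1 = byParity-1ℙ (trans (cong parity j≡2h+1) (parity-odd h))

  half-injective-even : ∀ {j j′} h h′ → toℕ j ≡ h + h → toℕ j′ ≡ h′ + h′ → half j ≡ half j′ → j ≡ j′
  half-injective-even {j} {j′} h h′ j≡2h j′≡2h′ hj≡hj′ = toℕ-injective (begin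
    toℕ j   ≡⟨ j≡2h ⟩
    h + h   ≡⟨ cong (λ x → x + x) h≡h′ ⟩
    h′ + h′ ≡⟨ j′≡2h′ ⟨
    toℕ j′  ∎)
    where
    open ≡-Reasoning
    h≡h′ : h ≡ h′
    h≡h′ = trans (sym (toℕ-half-even h j≡2h)) (trans (cong toℕ hj≡hj′) (toℕ-half-even h′ j′≡2h′))

  half-injective-odd : ∀ {j j′} h h′ → toℕ j ≡ suc (h + h) → toℕ j′ ≡ suc (h′ + h′) → half j ≡ half j′ → j ≡ j′
  half-injective-odd {j} {j′} h h′ j≡2h+1 j′≡2h′+1 hj≡hj′ = toℕ-injective (begin
    toℕ j         ≡⟨ j≡2h+1 ⟩
    suc (h + h)   ≡⟨ cong (λ x → suc (x + x)) h≡h′ ⟩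
    suc (h′ + h′) ≡⟨ j′≡2h′+1 ⟨
    toℕ j′        ∎)
    where
    open ≡-Reasoning
    h≡h′ : h ≡ h′
    h≡h′ = trans (sym (toℕ-half-odd h j≡2h+1)) (trans (cong toℕ hj≡hj′) (toℕ-half-odd h′ j′≡2h′+1))

  half≢opposite-half : ∀ {j j′} h h′ → toℕ j ≡ h + h → toℕ j′ ≡ suc (h′ + h′) → half j ≢ opposite (half j′)
  half≢opposite-half {j} {j′} h h′ j≡2h j′≡2h′+1 hj≡ = <-irrefl refl (begin-strict
    n₁ + n₁                     ≡⟨ cong (λ x → x + x) h+h′≡n₁ ⟨
    (h + h′) + (h + h′)         <⟨ n<1+n _ ⟩
    suc ((h + h′) + (h + h′))   ≡⟨ regroup h h′ ⟩
    h + h + suc (h′ + h′)       ≡⟨ cong₂ _+_ j≡2h j′≡2h′+1 ⟨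
    toℕ j + toℕ j′              ≤⟨ +-mono-≤ (s≤s⁻¹ (toℕ<n j)) (s≤s⁻¹ (toℕ<n j′)) ⟩
    n₁ + n₁                     ∎)
    where
    open ≤-Reasoning
    regroup : ∀ a b → suc ((a + b) + (a + b)) ≡ a + a + suc (b + b)
    regroup = solve-∀
    h+h′≡n₁ : h + h′ ≡ n₁
    h+h′≡n₁ = trans (cong (_+ h′) (trans (sym (toℕ-half-even h j≡2h)) (cong toℕ hj≡)))
                    (toℕ-opposite-half h′ j′≡2h′+1)

  edgeLabel-injective : ∀ i j i′ j′ → edgeLabel i j ≡ edgeLabel i′ j′ → i ≡ i′ × j ≡ j′
  edgeLabel-injective i j i′ j′ eq with halves (toℕ j) | halves (toℕ j′)
  ... | h , inj₁ e | h′ , inj₁ e′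
    with i≡i′ , hj≡hj′ ← combine-injective i _ i′ _
                           (subst₂ _≡_ (edgeLabel-even i h e) (edgeLabel-even i′ h′ e′) eq)
    = i≡i′ , half-injective-even h h′ e e′ hj≡hj′
  ... | h , inj₂ e | h′ , inj₂ e′
    with oi≡oi′ , ohj≡ohj′ ← combine-injective _ _ _ _
                               (subst₂ _≡_ (edgeLabel-odd i h e) (edgeLabel-odd i′ h′ e′) eq)
    = opposite-injective oi≡oi′ , half-injective-odd h h′ e e′ (opposite-injective ohj≡ohj′)
  ... | h , inj₁ e | h′ , inj₂ e′ = ⊥-elim (half≢opposite-half h h′ e e′
    (proj₂ (combine-injective i _ _ _ (subst₂ _≡_ (edgeLabel-even i h e) (edgeLabel-odd i′ h′ e′) eq))))
  ... | h , inj₂ e | h′ , inj₁ e′ = ⊥-elim (half≢opposite-half h′ h e′ e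
    (sym (proj₂ (combine-injective _ _ i′ _ (subst₂ _≡_ (edgeLabel-odd i h e) (edgeLabel-even i′ h′ e′) eq)))))

  labelling : Fin (r * n) → Fin (r * n)
  labelling e = let (i , j) = remQuot {r} n e in edgeLabel i j

  labelling-combine : ∀ i j → labelling (combine i j) ≡ edgeLabel i j
  labelling-combine i j rewrite quotRem-combine i j = refl

  labelling-injective : Injective _≡_ _≡_ labelling
  labelling-injective {e} {e′} eq =
    let i≡i′ , j≡j′ = edgeLabel-injective _ _ _ _ eq
    in trans (sym (combine-remQuot {r} n e)) (trans (cong₂ combine i≡i′ j≡j′) (combine-remQuot {r} n e′))

  ℓ₀ : Labeling G
  ℓ₀ = labelling , labelling-injective , Fin-injective⇒surjective labelling-injective

  L : Fin r → Fin n → ℕ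
  L i j = label G ℓ₀ (combine i j)

  L-even : ∀ i {j} h → toℕ j ≡ h + h → L i j ≡ suc (n * toℕ i + h)
  L-even i {j} h j≡2h = cong suc (begin
    toℕ (labelling (combine i j)) ≡⟨ cong toℕ (trans (labelling-combine i j) (edgeLabel-even i h j≡2h)) ⟩
    toℕ (combine i (half j))      ≡⟨ toℕ-combine i (half j) ⟩
    n * toℕ i + toℕ (half j)      ≡⟨ cong (n * toℕ i +_) (toℕ-half-even h j≡2h) ⟩
    n * toℕ i + h                 ∎)
    where open ≡-Reasoning

  L-odd : ∀ i {j} h → toℕ j ≡ suc (h + h) → L i j + h ≡ suc (n * toℕ (opposite i) + n₁)
  L-odd i {j} h j≡2h+1 = cong suc (begin
    toℕ (labelling (combine i j)) + h
      ≡⟨ cong (λ x → toℕ x + h) (trans (labelling-combine i j) (edgeLabel-odd i h j≡2h+1)) ⟩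
    toℕ (combine (opposite i) (opposite (half j))) + h
      ≡⟨ cong (_+ h) (toℕ-combine (opposite i) (opposite (half j))) ⟩
    n * toℕ (opposite i) + toℕ (opposite (half j)) + h
      ≡⟨ +-assoc (n * toℕ (opposite i)) _ h ⟩
    n * toℕ (opposite i) + (toℕ (opposite (half j)) + h)
      ≡⟨ cong (n * toℕ (opposite i) +_) (toℕ-opposite-half h j≡2h+1) ⟩
    n * toℕ (opposite i) + n₁ ∎)
    where open ≡-Reasoning

  A : ℕ
  A = suc (n * r)

  mirror-labels-sum : ∀ i → suc (n * toℕ (opposite i) + n₁) + suc (n * toℕ i) ≡ A
  mirror-labels-sum i = begin
    suc (n * toℕ (opposite i) + n₁) + suc (n * toℕ i) ≡⟨ regroup n₁ (toℕ (opposite i)) (toℕ i) ⟩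
    suc (n * (toℕ (opposite i) + suc (toℕ i)))        ≡⟨ cong (λ x → suc (n * x)) opposite+suc ⟩
    A                                                 ∎
    where
    open ≡-Reasoning
    regroup : ∀ n₁ o t → suc (suc n₁ * o + n₁) + suc (suc n₁ * t) ≡ suc (suc n₁ * (o + suc t))
    regroup = solve-∀
    opposite+suc : toℕ (opposite i) + suc (toℕ i) ≡ r
    opposite+suc = trans (cong (_+ suc (toℕ i)) (opposite-prop i)) (m∸n+n≡m (toℕ<n i))

  W : Fin r → Fin n → ℕ
  W i j = weight G ℓ₀ (combine i j)

  W-combine : ∀ i j → W i j ≡ L i j + L i (prev j)
  W-combine i j =
    trans (weight-rC n₁≥1 ℓ₀ (combine i j)) (cong (λ u → L i j + label G ℓ₀ u) (π-combine i j))

  W-odd : ∀ i {j} h → toℕ j ≡ suc (h + h) → W i j ≡ A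
  W-odd i {j} h j≡2h+1 = begin
    W i j                              ≡⟨ W-combine i j ⟩
    L i j + L i (prev j)               ≡⟨ cong (L i j +_) (L-even i h (toℕ-prev-suc j≡2h+1)) ⟩
    L i j + suc (n * t + h)            ≡⟨ shuffle (L i j) (n * t) h ⟩
    (L i j + h) + suc (n * t)          ≡⟨ cong (_+ suc (n * t)) (L-odd i h j≡2h+1) ⟩
    suc (n * o + n₁) + suc (n * t)     ≡⟨ mirror-labels-sum i ⟩
    A                                  ∎
    where
    open ≡-Reasoning
    t o : ℕ
    t = toℕ i
    o = toℕ (opposite i)
    shuffle : ∀ x c h → x + suc (c + h) ≡ (x + h) + suc c
    shuffle = solve-∀

  W-even : ∀ i {j} h → toℕ j ≡ suc (suc (h + h)) → W i j ≡ suc A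
  W-even i {j} h j≡2h+2 = begin
    W i j                              ≡⟨ W-combine i j ⟩
    L i j + L i (prev j)               ≡⟨ cong (_+ L i (prev j)) (L-even i (suc h) j≡2[h+1]) ⟩
    suc (n * t + suc h) + L i (prev j) ≡⟨ shuffle (n * t) h (L i (prev j)) ⟩
    suc ((L i (prev j) + h) + suc (n * t))
                                       ≡⟨ cong (λ x → suc (x + suc (n * t))) (L-odd i h (toℕ-prev-suc j≡2h+2)) ⟩
    suc (suc (n * o + n₁) + suc (n * t)) ≡⟨ cong suc (mirror-labels-sum i) ⟩
    suc A                              ∎
    where
    open ≡-Reasoning
    t o : ℕ
    t = toℕ i
    o = toℕ (opposite i)
    j≡2[h+1] : toℕ j ≡ suc h + suc h
    j≡2[h+1] = trans j≡2h+2 (cong suc (sym (+-suc h h)))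
    shuffle : ∀ c h x → suc (c + suc h) + x ≡ suc ((x + h) + suc c)
    shuffle = solve-∀

  W-first-≢-odd-cycle : ∀ i {j} h → n₁ ≡ h + h → toℕ j ≡ 0 → W i j ≢ A × W i j ≢ suc A
  W-first-≢-odd-cycle i {j} h n₁≡2h j≡0 =
    (λ W≡A → *+-nonzero-remainder≢* n (t + t) (suc h) r z<s (s≤s h<n₁)
               (trans (+-suc (n * (t + t)) h) (suc-injective (trans (sym W≡) W≡A)))) ,
    (λ W≡B → *+-nonzero-remainder≢* n (t + t) h r h≥1 (s≤s h≤n₁)
               (suc-injective (suc-injective (trans (sym W≡) W≡B))))
    where
    t : ℕ
    t = toℕ i
    h≥1 : 1 ≤ h
    h≥1 = n≢0⇒n>0 λ h≡0 → <⇒≢ n₁≥1 (sym (trans n₁≡2h (cong (λ x → x + x) h≡0)))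
    h≤n₁ : h ≤ n₁
    h≤n₁ = subst (h ≤_) (sym n₁≡2h) (m≤m+n h h)
    h<n₁ : h < n₁
    h<n₁ = subst (h <_) (sym n₁≡2h) (subst (_≤ h + h) (+-comm h 1) (+-monoʳ-≤ h h≥1))
    regroup : ∀ n t h → suc (n * t + 0) + suc (n * t + h) ≡ suc (suc (n * (t + t) + h))
    regroup = solve-∀
    W≡ : W i j ≡ suc (suc (n * (t + t) + h))
    W≡ = begin
      W i j                             ≡⟨ W-combine i j ⟩
      L i j + L i (prev j)              ≡⟨ cong₂ _+_ (L-even i 0 j≡0)
                                                     (L-even i h (trans (toℕ-prev-zero j≡0) n₁≡2h)) ⟩
      suc (n * t + 0) + suc (n * t + h) ≡⟨ regroup n t h ⟩
      suc (suc (n * (t + t) + h))       ∎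
      where open ≡-Reasoning

  W-first-<-even-cycle : ∀ i {j} h → n₁ ≡ suc (h + h) → toℕ j ≡ 0 → W i j < A
  W-first-<-even-cycle i {j} h n₁≡2h+1 j≡0 = subst (W i j <_) W+h≡A (m<m+n (W i j) h≥1)
    where
    open ≡-Reasoning
    t o : ℕ
    t = toℕ i
    o = toℕ (opposite i)
    h≥1 : 1 ≤ h
    h≥1 = n≢0⇒n>0 λ h≡0 → <-irrefl refl (subst (2 ≤_) (trans n₁≡2h+1 (cong (λ x → suc (x + x)) h≡0)) n₁≥2)
    W+h≡A : W i j + h ≡ A
    W+h≡A = begin
      W i j + h                      ≡⟨ cong (_+ h) (W-combine i j) ⟩
      (L i j + L i (prev j)) + h     ≡⟨ +-assoc (L i j) _ h ⟩
      L i j + (L i (prev j) + h)     ≡⟨ cong₂ _+_ (L-even i 0 j≡0)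
                                                  (L-odd i h (trans (toℕ-prev-zero j≡0) n₁≡2h+1)) ⟩
      suc (n * t + 0) + suc (n * o + n₁) ≡⟨ cong (λ x → suc x + suc (n * o + n₁)) (+-identityʳ (n * t)) ⟩
      suc (n * t) + suc (n * o + n₁) ≡⟨ +-comm (suc (n * t)) _ ⟩
      suc (n * o + n₁) + suc (n * t) ≡⟨ mirror-labels-sum i ⟩
      A                              ∎

  W-first-≢ : ∀ i {j} → toℕ j ≡ 0 → W i j ≢ A × W i j ≢ suc A
  W-first-≢ i {j} j≡0 with halves n₁
  ... | h , inj₁ n₁≡2h   = W-first-≢-odd-cycle i h n₁≡2h j≡0
  ... | h , inj₂ n₁≡2h+1 = <⇒≢ W<A , <⇒≢ (m<n⇒m<1+n W<A)
    where
    W<A : W i j < A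
    W<A = W-first-<-even-cycle i h n₁≡2h+1 j≡0

  W-later : ∀ i {j y} → toℕ j ≡ suc y → W i j ≡ A ⊎ W i j ≡ suc A
  W-later i {j} {y} j≡1+y with halves y
  ... | h , inj₁ y≡2h   = inj₁ (W-odd i h (trans j≡1+y (cong suc y≡2h)))
  ... | h , inj₂ y≡2h+1 = inj₂ (W-even i h (trans j≡1+y (cong suc y≡2h+1)))

  A≢1+A : A ≢ suc A
  A≢1+A = <⇒≢ (n<1+n A)

  W-≢-next : ∀ i j → W i j ≢ W i (next j)
  W-≢-next i j = differ (toℕ j) refl (s≤s⁻¹ (toℕ<n j))
    where
    differ : ∀ y → toℕ j ≡ y → y ≤ n₁ → W i j ≢ W i (next j)
    differ zero j≡0 _ eq = proj₁ (W-first-≢ i j≡0) (trans eq (W-odd i 0 (toℕ-next j≡0 n₁≥1)))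
    differ (suc y) j≡1+y 1+y≤n₁ eq with m≤n⇒m<n∨m≡n 1+y≤n₁
    ... | inj₂ 1+y≡n₁ =
      [ (λ W≡A → proj₁ next-first (trans (sym eq) W≡A)) , (λ W≡B → proj₂ next-first (trans (sym eq) W≡B)) ]′
      (W-later i j≡1+y)
      where
      next-first : W i (next j) ≢ A × W i (next j) ≢ suc A
      next-first = W-first-≢ i (toℕ-next-last (trans j≡1+y 1+y≡n₁))
    ... | inj₁ 1+y<n₁ with halves y
    ...   | h , inj₁ y≡2h =
      A≢1+A (trans (sym (W-odd i h (trans j≡1+y (cong suc y≡2h))))
                   (trans eq (W-even i h (trans (toℕ-next j≡1+y 1+y<n₁) (cong (λ x → suc (suc x)) y≡2h)))))
    ...   | h , inj₂ y≡2h+1 =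
      A≢1+A (trans (sym (W-odd i (suc h) (trans (toℕ-next j≡1+y 1+y<n₁)
                                                 (cong (λ x → suc (suc x)) (trans y≡2h+1 (sym (+-suc h h)))))))
                   (trans (sym eq) (W-even i h (trans j≡1+y (cong suc y≡2h+1)))))

  weights₀ : List ℕ
  weights₀ = A ∷ suc A ∷ map (λ i → W i Fin.zero) (allFin r)

  W-∈ : ∀ i j → W i j ∈ weights₀
  W-∈ i j = classify (toℕ j) refl
    where
    classify : ∀ y → toℕ j ≡ y → W i j ∈ weights₀
    classify zero    j≡0   = there (there (subst (_∈ _) (cong (W i) (toℕ-injective (sym j≡0)))
                                                     (∈-map⁺ (λ i → W i Fin.zero) (∈-allFin i))))
    classify (suc y) j≡1+y = [ here , there ∘ here ]′ (W-later i j≡1+y)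

  ℓ₀-numWeights : numWeights G ℓ₀ ≤ r + 2
  ℓ₀-numWeights = ≤-trans (numWeights-≤ G ℓ₀ weights₀ weight-∈) (≤-reflexive length-weights₀)
    where
    weight-∈ : ∀ u → weight G ℓ₀ u ∈ weights₀
    weight-∈ u = subst (_∈ weights₀) (cong (weight G ℓ₀) (combine-remQuot {r} n u)) (W-∈ _ _)
    length-weights₀ : length weights₀ ≡ r + 2
    length-weights₀ = trans (cong (λ x → suc (suc x)) (trans (length-map _ (allFin r)) (length-tabulate id)))
                            (+-comm 2 r)

  ℓ₀-localAntimagic : IsLocalAntimagic G ℓ₀
  ℓ₀-localAntimagic e eq = let (i , j) = remQuot {r} n e in W-≢-next i j (begin
    W i j                          ≡⟨ cong (weight G ℓ₀) (trans (combine-remQuot {r} n e) (sym (source≡ e))) ⟩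
    weight G ℓ₀ (proj₁ (ends G e)) ≡⟨ eq ⟩
    weight G ℓ₀ (σ e)              ≡⟨ cong (weight G ℓ₀ ∘ σ) (sym (combine-remQuot {r} n e)) ⟩
    weight G ℓ₀ (σ (combine i j))  ≡⟨ cong (weight G ℓ₀) (σ-combine i j) ⟩
    W i (next j)                   ∎)
    where open ≡-Reasoning

rC-labelling : ∀ r n₁ → 2 ≤ n₁ →
               Σ (Labeling (rC r (suc n₁))) λ ℓ →
                 IsLocalAntimagic (rC r (suc n₁)) ℓ × numWeights (rC r (suc n₁)) ℓ ≤ r + 2
rC-labelling r n₁ n₁≥2 = ℓ₀ , ℓ₀-localAntimagic , ℓ₀-numWeights
  where open Construction r n₁ n₁≥2

mainTheorem4 : (r n : ℕ) → 1 ≤ r → 3 ≤ n →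
    Σ ℕ λ k → IsChiLa (rC r n) k × 3 ≤ k × k ≤ r + 2
mainTheorem4 r (suc n₁) r≥1 (s≤s n₁≥2) with rC-labelling r n₁ n₁≥2
... | ℓ , ℓ-antimagic , ℓ≤r+2 with χla-exists (rC r (suc n₁)) ℓ ℓ-antimagic
... | k , χ@((ℓ′ , ℓ′-antimagic , refl) , _) , k≤ =
  k , χ , numWeights-rC-≥3 r n₁ r≥1 (≤-trans (n≤1+n 1) n₁≥2) ℓ′ ℓ′-antimagic , ≤-trans k≤ ℓ≤r+2
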